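{- Let $\mathcal{J}$ be a propositional formula and $\mathcal{N}$ a CNF formula with $\mathcal{J}\not\models\mathcal{N}$. Let $\mathcal{R}=\mathcal{N}$ and for $\mathcal{W}\subseteq\mathcal{R}$ let $P(\mathcal{W})=\neg\mathrm{SAT}\big(\mathcal{J}\wedge\bigvee_{c\in\mathcal{R}\setminus\mathcal{W}}\neg c\big)$. Then $P$ is monotone, and for every minimal subset $\mathcal{W}\subseteq\mathcal{R}$ for $P$, the set $\mathcal{I}=\mathcal{N}\setminus\mathcal{W}$ is a Maximal Entailed Subset, i.e. $\mathcal{J}\models\mathcal{I}$ and $\mathcal{J}\not\models\mathcal{I}'$ for every $\mathcal{I}'$ with $\mathcal{I}\subsetneq\mathcal{I}'\subseteq\mathcal{N}$. (Hence FMxES reduces to the MSMP problem.)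
   Context: A CNF formula is a set of clauses; $\neg c$ is the negation of clause $c$; an empty disjunction is false. $\mathrm{SAT}(\varphi)$ is $1$ iff $\varphi$ is satisfiable. A predicate $P:2^{\mathcal{R}}\to\{0,1\}$ is monotone if $P(\mathcal{R}_0)$ and $\mathcal{R}_0\subseteq\mathcal{R}_1\subseteq\mathcal{R}$ imply $P(\mathcal{R}_1)$; $\mathcal{M}\subseteq\mathcal{R}$ is minimal for $P$ if $P(\mathcal{M})$ holds and $P(\mathcal{M}')$ fails for every $\mathcal{M}'\subsetneq\mathcal{M}$. The MSMP problem asks for a minimal set for a given monotone predicate. -}

module Defs where

open import Data.Nat using (ℕ; suc)
open import Data.Bool using (Bool; true; false; _∧_; _∨_; not; if_then_else_)
open import Data.List using (List; []; _∷_)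
open import Data.Vec using (Vec; []; _∷_; lookup)
open import Data.Fin using (Fin)
open import Data.Fin.Subset using (Subset; _∈_; _⊆_; _⊂_)
open import Data.Product using (∃; _×_)
open import Relation.Nullary using (¬_)
open import Relation.Binary.PropositionalEquality using (_≡_)

Assignment : Set
Assignment = ℕ → Bool

data Formula : Set where
  var  : ℕ → Formula
  ⊤f   : Formula
  ⊥f   : Formula
  ¬f_  : Formula → Formula
  _∧f_ : Formula → Formula → Formula
  _∨f_ : Formula → Formula → Formula

eval : Formula → Assignment → Bool
eval (var x)   α = α x
eval ⊤f        α = true
eval ⊥f        α = false
eval (¬f φ)    α = not (eval φ α)
eval (φ ∧f ψ)  α = eval φ α ∧ eval ψ α
eval (φ ∨f ψ)  α = eval φ α ∨ eval ψ α

data Literal : Set where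
  pos : ℕ → Literal
  neg : ℕ → Literal

Clause : Set
Clause = List Literal

litFormula : Literal → Formula
litFormula (pos x) = var x
litFormula (neg x) = ¬f (var x)

clauseFormula : Clause → Formula
clauseFormula []       = ⊥f
clauseFormula (l ∷ c)  = litFormula l ∨f clauseFormula c

SAT : Formula → Set
SAT φ = ∃ λ α → eval φ α ≡ true

-- A CNF formula with n clauses is given as a vector of pairwise distinct clauses;
-- subsets of it are represented by Subset n (subsets of clause indices).
Distinct : ∀ {n} → Vec Clause n → Set
Distinct {n} N = ∀ (i j : Fin n) → lookup N i ≡ lookup N j → i ≡ j

_⊨[_]_ : ∀ {n} → Formula → Vec Clause n → Subset n → Set
_⊨[_]_ {n} J N S =
  ∀ (α : Assignment) → eval J α ≡ true →
  ∀ (i : Fin n) → i ∈ S → eval (clauseFormula (lookup N i)) α ≡ true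

full : ∀ {n} → Subset n
full {n} = Data.Vec.replicate n true

disjNegOutside : ∀ {n} → Vec Clause n → Subset n → Formula
disjNegOutside []       []            = ⊥f
disjNegOutside (c ∷ N)  (true  ∷ W)   = disjNegOutside N W
disjNegOutside (c ∷ N)  (false ∷ W)   = (¬f clauseFormula c) ∨f disjNegOutside N W

P : ∀ {n} → Formula → Vec Clause n → Subset n → Set
P J N W = ¬ SAT (J ∧f disjNegOutside N W)

Monotone : ∀ {n} → (Subset n → Set) → Set
Monotone {n} Q = ∀ (R₀ R₁ : Subset n) → Q R₀ → R₀ ⊆ R₁ → Q R₁

Minimal : ∀ {n} → (Subset n → Set) → Subset n → Set
Minimal {n} Q M = Q M × (∀ (M' : Subset n) → M' ⊂ M → ¬ Q M')

MES : ∀ {n} → Formula → Vec Clause n → Subset n → Set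
MES {n} J N I = (J ⊨[ N ] I) × (∀ (I' : Subset n) → I ⊂ I' → ¬ (J ⊨[ N ] I'))

-- P(W) holds exactly when J entails every clause outside W: a model of J falsifying
-- some clause c ∉ W is precisely a model of J ∧ ⋁_{c ∉ W} ¬c. So P is "J entails the
-- complement", which is monotone because entailment is antitone in the set of clauses,
-- and complementation, being an order-reversing involution on subsets, turns a minimal W
-- into a maximal entailed ∁ W.
module Submission where

open import Defs
open import Data.Nat using (ℕ)
open import Data.Vec using (Vec; []; _∷_; lookup; here; there)
open import Data.Fin using (zero; suc)
open import Data.Fin.Subset using (Subset; ∁; _∉_; _⊆_; _⊂_)
open import Data.Fin.Subset.Properties
  using (x∈∁p⇒x∉p; x∉p⇒x∈∁p; x∉∁p⇒x∈p; x∈p⇒x∉∁p; p⊆q⇒∁p⊇∁q)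
open import Data.Bool using (Bool; true; false; _∧_)
open import Data.Bool.Properties using (∨-zeroʳ)
open import Data.Product using (_×_; _,_; ∃)
open import Data.Empty using (⊥-elim)
open import Function using (_∘_)
open import Relation.Nullary using (¬_)
open import Relation.Binary.PropositionalEquality using (_≡_; refl; sym; trans)

∁∁p⊆p : ∀ {n} {p : Subset n} → ∁ (∁ p) ⊆ p
∁∁p⊆p = x∉∁p⇒x∈p ∘ x∈∁p⇒x∉p

∁p⊂q⇒∁q⊂p : ∀ {n} {p q : Subset n} → ∁ p ⊂ q → ∁ q ⊂ p
∁p⊂q⇒∁q⊂p (∁p⊆q , x , x∈q , x∉∁p) =
  (∁∁p⊆p ∘ p⊆q⇒∁p⊇∁q ∁p⊆q) , x , x∉∁p⇒x∈p x∉∁p , x∈p⇒x∉∁p x∈q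

∧≡true⇒≡true : ∀ {x y : Bool} → x ∧ y ≡ true → x ≡ true × y ≡ true
∧≡true⇒≡true {true} {true} refl = refl , refl

⊨-antitone : ∀ {n} (J : Formula) (N : Vec Clause n) {S T : Subset n} →
  S ⊆ T → J ⊨[ N ] T → J ⊨[ N ] S
⊨-antitone J N S⊆T J⊨T α Jα i i∈S = J⊨T α Jα i (S⊆T i∈S)

FalsifiedOutside : ∀ {n} → Vec Clause n → Subset n → Assignment → Set
FalsifiedOutside N W α = ∃ λ i → i ∉ W × eval (clauseFormula (lookup N i)) α ≡ false

disjNegOutside⇒falsifiedOutside : ∀ {n} (N : Vec Clause n) (W : Subset n) (α : Assignment) →
  eval (disjNegOutside N W) α ≡ true → FalsifiedOutside N W α
disjNegOutside⇒falsifiedOutside [] [] α ()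
disjNegOutside⇒falsifiedOutside (c ∷ N) (true ∷ W) α e
  with i , i∉W , f ← disjNegOutside⇒falsifiedOutside N W α e =
    suc i , (λ { (there i∈W) → i∉W i∈W }) , f
disjNegOutside⇒falsifiedOutside (c ∷ N) (false ∷ W) α e with eval (clauseFormula c) α in ec
... | false = zero , (λ ()) , ec
... | true with i , i∉W , f ← disjNegOutside⇒falsifiedOutside N W α e =
    suc i , (λ { (there i∈W) → i∉W i∈W }) , f

falsifiedOutside⇒disjNegOutside : ∀ {n} (N : Vec Clause n) (W : Subset n) (α : Assignment) →
  FalsifiedOutside N W α → eval (disjNegOutside N W) α ≡ true
falsifiedOutside⇒disjNegOutside (c ∷ N) (true ∷ W) α (zero , i∉W , f) = ⊥-elim (i∉W here)
falsifiedOutside⇒disjNegOutside (c ∷ N) (true ∷ W) α (suc i , i∉W , f) =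
  falsifiedOutside⇒disjNegOutside N W α (i , i∉W ∘ there , f)
falsifiedOutside⇒disjNegOutside (c ∷ N) (false ∷ W) α (zero , i∉W , f) rewrite f = refl
falsifiedOutside⇒disjNegOutside (c ∷ N) (false ∷ W) α (suc i , i∉W , f)
  rewrite falsifiedOutside⇒disjNegOutside N W α (i , i∉W ∘ there , f) = ∨-zeroʳ _

P⇒⊨∁ : ∀ {n} (J : Formula) (N : Vec Clause n) (W : Subset n) → P J N W → J ⊨[ N ] ∁ W
P⇒⊨∁ J N W pW α Jα i i∈∁W with eval (clauseFormula (lookup N i)) α in ec
... | true  = refl
... | false = ⊥-elim (pW (α , Jα∧disj))
  where
  Jα∧disj : eval J α ∧ eval (disjNegOutside N W) α ≡ true
  Jα∧disj rewrite Jα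
    | falsifiedOutside⇒disjNegOutside N W α (i , x∈∁p⇒x∉p i∈∁W , ec) = refl

⊨∁⇒P : ∀ {n} (J : Formula) (N : Vec Clause n) (W : Subset n) → J ⊨[ N ] ∁ W → P J N W
⊨∁⇒P J N W J⊨∁W (α , e)
  with Jα , disj ← ∧≡true⇒≡true {eval J α} e
  with i , i∉W , f ← disjNegOutside⇒falsifiedOutside N W α disj
  with () ← trans (sym f) (J⊨∁W α Jα i (x∉p⇒x∈∁p i∉W))

proposition20 : (n : ℕ) (J : Formula) (N : Vec Clause n) → Distinct N →
    ¬ (J ⊨[ N ] full) →
    Monotone (P J N) ×
      (∀ (W : Subset n) → Minimal (P J N) W → MES J N (∁ W))
proposition20 n J N _ _ = monotone , minimal⇒MES
  where
  monotone : Monotone (P J N)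
  monotone R₀ R₁ pR₀ R₀⊆R₁ =
    ⊨∁⇒P J N R₁ (⊨-antitone J N (p⊆q⇒∁p⊇∁q R₀⊆R₁) (P⇒⊨∁ J N R₀ pR₀))

  minimal⇒MES : ∀ (W : Subset n) → Minimal (P J N) W → MES J N (∁ W)
  minimal⇒MES W (pW , minW) = P⇒⊨∁ J N W pW , λ I' ∁W⊂I' J⊨I' →
    minW (∁ I') (∁p⊂q⇒∁q⊂p ∁W⊂I') (⊨∁⇒P J N (∁ I') (⊨-antitone J N ∁∁p⊆p J⊨I'))
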